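{- For every $n = 3m$, where $m$ is a positive integer, there exists a planar triangulation with $n$ vertices whose oriented diameter is at least $n/3$.
   Context: A planar triangulation is a plane graph with at least three vertices in which every face, including the outer face, is bounded by exactly three vertices. An orientation of an undirected graph assigns a direction to each edge; it is strongly connected if every vertex can reach every other vertex by a directed path. The diameter of a directed graph is the maximum, over all ordered pairs of vertices, of the shortest directed path distance, measured in number of edges. The oriented diameter of an undirected graph $G$ is the minimum diameter over all strongly connected orientations of $G$. -}

module Defs where

open import Data.Nat using (ℕ; zero; suc; _+_; _*_; _≤_; _<_)
open import Data.Fin using (Fin)
open import Data.Bool using (Bool; true; false; not)
open import Data.Product using (Σ; ∃; ∃-syntax; _×_; _,_)
open import Data.Sum using (_⊎_)
open import Relation.Binary.PropositionalEquality using (_≡_; _≢_)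
open import Relation.Nullary using (¬_)
open import Function using (_∘_)
open import Level using (0ℓ)

iter : ∀ {A : Set} → ℕ → (A → A) → A → A
iter zero    f x = x
iter (suc k) f x = f (iter k f x)

-- Plane graphs, combinatorially: a plane embedding of a connected graph
-- is represented (up to orientation-preserving homeomorphism of the
-- sphere) by a combinatorial map (rotation system):
--   * darts (half-edges)  Fin d
--   * α : fixed-point-free involution pairing the two darts of an edge
--   * σ : permutation giving the cyclic order of darts around a vertex
--   * vertices = σ-orbits, faces = orbits of φ = σ ∘ α
--   * the map is connected, and it is a sphere (plane) embedding iff
--     Euler's formula V - E + F = 2 holds.

data MapReach {d : ℕ} (σ σ⁻ α : Fin d → Fin d) (x : Fin d) : Fin d → Set where
  here : MapReach σ σ⁻ α x x
  stepσ  : ∀ {y} → MapReach σ σ⁻ α x y → MapReach σ σ⁻ α x (σ y)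
  stepσ⁻ : ∀ {y} → MapReach σ σ⁻ α x y → MapReach σ σ⁻ α x (σ⁻ y)
  stepα  : ∀ {y} → MapReach σ σ⁻ α x y → MapReach σ σ⁻ α x (α y)

record PlaneTriangulation (n : ℕ) : Set where
  field
    -- number of darts (= 2 · number of edges)
    d     : ℕ
    σ σ⁻ α : Fin d → Fin d
    σ-inv₁ : ∀ x → σ (σ⁻ x) ≡ x
    σ-inv₂ : ∀ x → σ⁻ (σ x) ≡ x
    α-invol : ∀ x → α (α x) ≡ x
    α-nofix : ∀ x → α x ≢ x
    vtx   : Fin d → Fin n
    vtx-σ : ∀ x → vtx (σ x) ≡ vtx x
    vtx-orbit : ∀ x y → vtx x ≡ vtx y → ∃[ k ] iter k σ x ≡ y
    vtx-surj  : ∀ u → ∃[ x ] vtx x ≡ u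
    connected : ∀ x y → MapReach σ σ⁻ α x y
    three≤n : 3 ≤ n
    noLoop  : ∀ x → vtx (α x) ≢ vtx x
    noMulti : ∀ x y → vtx x ≡ vtx y → vtx (α x) ≡ vtx (α y) → x ≡ y
    face3   : ∀ x → iter 3 (σ ∘ α) x ≡ x
    faceNo1 : ∀ x → (σ ∘ α) x ≢ x
    faceVtx₁ : ∀ x → vtx x ≢ vtx ((σ ∘ α) x)
    faceVtx₂ : ∀ x → vtx x ≢ vtx (iter 2 (σ ∘ α) x)
    -- Euler's formula V - E + F = 2 (genus 0, i.e. a plane embedding),
    -- with E = d/2 and F = d/3 (all faces have 3 darts); multiplied by 6:
    -- 6V - 3d + 2d = 12.
    euler : 6 * n ≡ d + 12

  Adj : Fin n → Fin n → Set
  Adj u w = ∃[ x ] (vtx x ≡ u × vtx (α x) ≡ w)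

module _ {n : ℕ} (G : PlaneTriangulation n) where
  open PlaneTriangulation G

  record Orientation : Set where
    field
      arc      : Fin n → Fin n → Bool
      arc-edge : ∀ u w → arc u w ≡ true → Adj u w
      orient   : ∀ u w → Adj u w → (arc u w ≡ true) ⊎ (arc w u ≡ true)
      antisym  : ∀ u w → arc u w ≡ true → arc w u ≡ false

  data Walk (O : Orientation) : ℕ → Fin n → Fin n → Set where
    nil  : ∀ {u} → Walk O 0 u u
    cons : ∀ {k u v w} → Orientation.arc O u v ≡ true → Walk O k v w → Walk O (suc k) u w

  StronglyConnected : Orientation → Set
  StronglyConnected O = ∀ u w → ∃[ k ] Walk O k u w

  DistAtLeast : Orientation → Fin n → Fin n → ℕ → Set
  DistAtLeast O u w m = ∀ k → k < m → ¬ Walk O k u w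

  DiameterAtLeast : Orientation → ℕ → Set
  DiameterAtLeast O m = ∃[ u ] ∃[ w ] DistAtLeast O u w m

  OrientedDiameterAtLeast : ℕ → Set
  OrientedDiameterAtLeast m = ∀ (O : Orientation) → StronglyConnected O → DiameterAtLeast O m

-- The witness is the triangulation by m nested triangles.  Layer l is the triangle on
-- (l , 0), (l , 1), (l , 2); consecutive layers are joined by a band of six triangles, and
-- the innermost and outermost triangles are faces.  Adjacent vertices lie on equal or
-- consecutive layers, and the bands are chosen so that x₀ = (0 , 0) has a single neighbour
-- off layer 0, namely w₀ = (1 , 0).  Fix a strong orientation and a vertex y₀ on the last
-- layer.  If the edge x₀w₀ points to x₀, every walk from x₀ first stays on layer 0, so
-- reaching y₀ takes at least 1 + (m - 1) steps; otherwise every walk into x₀ makes its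
-- last step from layer 0, and walks from y₀ to x₀ need m steps as well.  Both bounds come
-- from a potential that grows by at most one along every arc: 1 + layer (and 0 at x₀),
-- resp. (m - 1) - layer (and m at x₀).  For m = 1 any two distinct vertices will do.

module Submission where

open import Defs
open import Data.Nat using (ℕ; zero; suc; _+_; _*_; _∸_; _≤_; z≤n; s≤s)
open import Data.Nat.Properties
  using (≤-refl; ≤-trans; ≤-reflexive; n≤1+n; m∸n≤m; n∸n≡0; +-suc; +-identityʳ; +-monoʳ-≤; +-monoˡ-≤; <⇒≱; m≤m*n;
         m≤n+m∸n; m≤n+o⇒m∸n≤o; 1+n≢0; module ≤-Reasoning)
open import Data.Fin using (Fin; zero; suc; toℕ; inject₁; fromℕ; opposite; _≟_)
open import Data.Fin.Patterns using (0F; 1F; 2F; 3F; 4F; 5F)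
open import Data.Fin.Properties using (suc-injective; toℕ-inject₁; toℕ-fromℕ; 1↔⊤; +↔⊎; *↔×)
open import Data.Fin.Induction using (<-weakInduction)
open import Data.Vec.Functional using (updateAt)
open import Data.Vec.Functional.Properties using (updateAt-updates; updateAt-minimal)
open import Data.Product using (∃-syntax; _×_; _,_; proj₁; proj₂)
open import Data.Sum using (_⊎_; inj₁; inj₂)
open import Data.Bool using (true; false)
open import Data.Empty using (⊥-elim)
open import Function using (_∘_; const)
open import Function.Bundles using (_↔_; Inverse; Injection; mk↔ₛ′)
open import Function.Properties.Inverse using (↔-refl; ↔-sym; ↔-trans; ↔⇒↣)
open import Data.Product.Algebra using (×-cong; ×-comm)
open import Data.Sum.Algebra using (⊎-cong)
open import Data.Unit using (⊤; tt)
open import Data.Nat.Solver using (module +-*-Solver)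
open import Relation.Binary.PropositionalEquality
open import Relation.Nullary using (yes; no; contradiction)

iter-semiconj : ∀ {A B : Set} {f : A → A} {g : B → B} {h : A → B} →
                (∀ x → g (h x) ≡ h (f x)) → ∀ k x → iter k g (h x) ≡ h (iter k f x)
iter-semiconj comm zero    x = refl
iter-semiconj {f = f} {g} {h} comm (suc k) x =
  trans (cong g (iter-semiconj comm k x)) (comm (iter k f x))

iter-cong : ∀ {A : Set} {f g : A → A} → (∀ x → g x ≡ f x) → ∀ k x → iter k g x ≡ iter k f x
iter-cong = iter-semiconj {h = λ x → x}

Orbit : ∀ {A : Set} → (A → A) → A → A → Set
Orbit f x y = ∃[ k ] iter k f x ≡ y

orbit-post : ∀ {A : Set} {f : A → A} {x y} → Orbit f x y → Orbit f x (f y)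
orbit-post (k , p) = suc k , cong _ p

orbit-from : ∀ {A : Set} {f : A → A} {x y} → x ≡ y → ∀ k → Orbit f x (iter k f y)
orbit-from refl k = k , refl

orbit-trans : ∀ {A : Set} {f : A → A} {x y z} → Orbit f x y → Orbit f y z → Orbit f x z
orbit-trans {f = f} {x} {y} (k , p) (l , q) = l + k , trans (iter-+ l) q
  where
  iter-+ : ∀ l → iter (l + k) f x ≡ iter l f y
  iter-+ zero    = p
  iter-+ (suc l) = cong f (iter-+ l)

data MapReachOn {A : Set} (σ σ⁻ α : A → A) (x : A) : A → Set where
  here   : MapReachOn σ σ⁻ α x x
  stepσ  : ∀ {y} → MapReachOn σ σ⁻ α x y → MapReachOn σ σ⁻ α x (σ y)
  stepσ⁻ : ∀ {y} → MapReachOn σ σ⁻ α x y → MapReachOn σ σ⁻ α x (σ⁻ y)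
  stepα  : ∀ {y} → MapReachOn σ σ⁻ α x y → MapReachOn σ σ⁻ α x (α y)

module _ {A : Set} {σ σ⁻ α : A → A}
         (σ-inv₁ : ∀ x → σ (σ⁻ x) ≡ x) (σ-inv₂ : ∀ x → σ⁻ (σ x) ≡ x)
         (α-invol : ∀ x → α (α x) ≡ x) where

  private
    Reach = MapReachOn σ σ⁻ α

  reach-trans : ∀ {x y z} → Reach x y → Reach y z → Reach x z
  reach-trans p here       = p
  reach-trans p (stepσ q)  = stepσ (reach-trans p q)
  reach-trans p (stepσ⁻ q) = stepσ⁻ (reach-trans p q)
  reach-trans p (stepα q)  = stepα (reach-trans p q)

  reach-sym : ∀ {x y} → Reach x y → Reach y x
  reach-sym here                = here
  reach-sym (stepσ {y} p)  = reach-trans (subst (Reach (σ y)) (σ-inv₂ y) (stepσ⁻ here)) (reach-sym p)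
  reach-sym (stepσ⁻ {y} p) = reach-trans (subst (Reach (σ⁻ y)) (σ-inv₁ y) (stepσ here)) (reach-sym p)
  reach-sym (stepα {y} p)  = reach-trans (subst (Reach (α y)) (α-invol y) (stepα here)) (reach-sym p)

-- PlaneTriangulation without its counting fields, for arbitrary dart and vertex types.
record Triangulation (Dart Vertex : Set) : Set where
  field
    σ σ⁻ α    : Dart → Dart
    σ-inv₁    : ∀ x → σ (σ⁻ x) ≡ x
    σ-inv₂    : ∀ x → σ⁻ (σ x) ≡ x
    α-invol   : ∀ x → α (α x) ≡ x
    α-nofix   : ∀ x → α x ≢ x
    vtx       : Dart → Vertex
    vtx-σ     : ∀ x → vtx (σ x) ≡ vtx x
    vtx-orbit : ∀ x y → vtx x ≡ vtx y → Orbit σ x y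
    vtx-surj  : ∀ u → ∃[ x ] vtx x ≡ u
    connected : ∀ x y → MapReachOn σ σ⁻ α x y
    noLoop    : ∀ x → vtx (α x) ≢ vtx x
    noMulti   : ∀ x y → vtx x ≡ vtx y → vtx (α x) ≡ vtx (α y) → x ≡ y
    face3     : ∀ x → iter 3 (σ ∘ α) x ≡ x
    faceNo1   : ∀ x → (σ ∘ α) x ≢ x
    faceVtx₁  : ∀ x → vtx x ≢ vtx ((σ ∘ α) x)
    faceVtx₂  : ∀ x → vtx x ≢ vtx (iter 2 (σ ∘ α) x)

module Transport {Dart Vertex : Set} {d n : ℕ}
                 (darts : Dart ↔ Fin d) (vertices : Vertex ↔ Fin n)
                 (T : Triangulation Dart Vertex) (three≤n : 3 ≤ n) (euler : 6 * n ≡ d + 12) where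

  private
    module D = Inverse darts
    module V = Inverse vertices
  open Triangulation T

  private
    code-elim : ∀ (P : Fin d → Set) → (∀ x → P (D.to x)) → ∀ k → P k
    code-elim P p k = subst P (D.strictlyInverseˡ k) (p (D.from k))

    D-injective : ∀ {x y} → D.to x ≡ D.to y → x ≡ y
    D-injective = Injection.injective (↔⇒↣ darts)

    conj : (Dart → Dart) → Fin d → Fin d
    conj f = D.to ∘ f ∘ D.from

    conj-to : ∀ f x → conj f (D.to x) ≡ D.to (f x)
    conj-to f x = cong (D.to ∘ f) (D.strictlyInverseʳ x)

    σ′ σ⁻′ α′ : Fin d → Fin d
    σ′  = conj σ
    σ⁻′ = conj σ⁻
    α′  = conj α

    conj-inverse : ∀ f g → (∀ x → f (g x) ≡ x) → ∀ k → conj f (conj g k) ≡ k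
    conj-inverse f g fg = code-elim _ λ x →
      trans (cong (conj f) (conj-to g x)) (trans (conj-to f (g x)) (cong D.to (fg x)))

    φ′-to : ∀ x → σ′ (α′ (D.to x)) ≡ D.to (σ (α x))
    φ′-to x = trans (cong σ′ (conj-to α x)) (conj-to σ (α x))

    iter-φ′-to : ∀ k x → iter k (σ′ ∘ α′) (D.to x) ≡ D.to (iter k (σ ∘ α) x)
    iter-φ′-to = iter-semiconj φ′-to

    vtx′ : Fin d → Fin n
    vtx′ = V.to ∘ vtx ∘ D.from

    vtx′-to : ∀ x → vtx′ (D.to x) ≡ V.to (vtx x)
    vtx′-to x = cong (V.to ∘ vtx) (D.strictlyInverseʳ x)

    vtx′-injective : ∀ {x y} → vtx′ (D.to x) ≡ vtx′ (D.to y) → vtx x ≡ vtx y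
    vtx′-injective {x} {y} p = Injection.injective (↔⇒↣ vertices) (trans (sym (vtx′-to x)) (trans p (vtx′-to y)))

    vtx′-α′ : ∀ x → vtx′ (α′ (D.to x)) ≡ vtx′ (D.to (α x))
    vtx′-α′ x = cong vtx′ (conj-to α x)

    reach-to : ∀ {x y} → MapReachOn σ σ⁻ α x y → MapReach σ′ σ⁻′ α′ (D.to x) (D.to y)
    reach-to here           = here
    reach-to (stepσ {y} p)  = subst (MapReach σ′ σ⁻′ α′ _) (conj-to σ y) (stepσ (reach-to p))
    reach-to (stepσ⁻ {y} p) = subst (MapReach σ′ σ⁻′ α′ _) (conj-to σ⁻ y) (stepσ⁻ (reach-to p))
    reach-to (stepα {y} p)  = subst (MapReach σ′ σ⁻′ α′ _) (conj-to α y) (stepα (reach-to p))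

  transport : PlaneTriangulation n
  transport = record
    { d         = d
    ; σ         = σ′
    ; σ⁻        = σ⁻′
    ; α         = α′
    ; σ-inv₁    = conj-inverse σ σ⁻ σ-inv₁
    ; σ-inv₂    = conj-inverse σ⁻ σ σ-inv₂
    ; α-invol   = conj-inverse α α α-invol
    ; α-nofix   = code-elim _ λ x p → α-nofix x (D-injective (trans (sym (conj-to α x)) p))
    ; vtx       = vtx′
    ; vtx-σ     = code-elim _ λ x → trans (cong vtx′ (conj-to σ x)) (trans (vtx′-to (σ x))
                    (trans (cong V.to (vtx-σ x)) (sym (vtx′-to x))))
    ; vtx-orbit = code-elim _ λ x → code-elim _ λ y p →
                    let (k , q) = vtx-orbit x y (vtx′-injective p) in
                    k , trans (iter-semiconj (conj-to σ) k x) (cong D.to q)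
    ; vtx-surj  = λ u → let (x , p) = vtx-surj (V.from u) in
                    D.to x , trans (vtx′-to x) (trans (cong V.to p) (V.strictlyInverseˡ u))
    ; connected = code-elim _ λ x → code-elim _ λ y → reach-to (connected x y)
    ; three≤n   = three≤n
    ; noLoop    = code-elim _ λ x p → noLoop x (vtx′-injective (trans (sym (vtx′-α′ x)) p))
    ; noMulti   = code-elim _ λ x → code-elim _ λ y p q → cong D.to (noMulti x y (vtx′-injective p)
                    (vtx′-injective (trans (sym (vtx′-α′ x)) (trans q (vtx′-α′ y)))))
    ; face3     = code-elim _ λ x → trans (iter-φ′-to 3 x) (cong D.to (face3 x))
    ; faceNo1   = code-elim _ λ x p → faceNo1 x (D-injective (trans (sym (φ′-to x)) p))
    ; faceVtx₁  = code-elim _ λ x p → faceVtx₁ x (vtx′-injective (trans p (cong vtx′ (φ′-to x))))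
    ; faceVtx₂  = code-elim _ λ x p → faceVtx₂ x (vtx′-injective (trans p (cong vtx′ (iter-φ′-to 2 x))))
    ; euler     = euler
    }

  transport-Adj : ∀ {u w} → PlaneTriangulation.Adj transport u w →
                  ∃[ x ] (vtx x ≡ V.from u × vtx (α x) ≡ V.from w)
  transport-Adj (k , p , q) =
    D.from k , sym (V.inverseʳ (sym p)) , sym (V.inverseʳ (trans (sym q) (vtx′-to (α (D.from k)))))

-- Lipschitz potentials bound directed distances
module _ {n : ℕ} (G : PlaneTriangulation n) where
  open PlaneTriangulation G

  Adj-sym : ∀ {u w} → Adj u w → Adj w u
  Adj-sym (x , p , q) = α x , q , trans (cong vtx (α-invol x)) p

  module _ (O : Orientation G) where
    open Orientation O

    ArcLipschitz : (Fin n → ℕ) → Set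
    ArcLipschitz p = ∀ u v → arc u v ≡ true → p v ≤ suc (p u)

    walk-potential : ∀ {p} → ArcLipschitz p → ∀ {k u v} → Walk G O k u v → p v ≤ k + p u
    walk-potential lip nil = ≤-refl
    walk-potential {p} lip {suc k} (cons {v = u′} a w) =
      ≤-trans (walk-potential lip w) (≤-trans (+-monoʳ-≤ k (lip _ u′ a)) (≤-reflexive (+-suc k (p _))))

    potential-dist : ∀ {p} → ArcLipschitz p → ∀ {u v m} → p u ≡ 0 → p v ≡ m → DistAtLeast G O u v m
    potential-dist {p} lip {u} {v} pu≡0 pv≡m k k<m w =
      <⇒≱ k<m (subst₂ _≤_ pv≡m (trans (cong (k +_) pu≡0) (+-identityʳ k)) (walk-potential lip w))

    updateAt-lipschitz : ∀ {p x c} → ArcLipschitz p →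
                         (∀ v → arc x v ≡ true → p v ≤ suc c) →
                         (∀ u → arc u x ≡ true → c ≤ suc (p u)) →
                         ArcLipschitz (updateAt p x (const c))
    updateAt-lipschitz {p} {x} {c} lip out into u v a with u ≟ x | v ≟ x
    ... | yes refl | yes refl rewrite updateAt-updates x {const c} p = n≤1+n c
    ... | yes refl | no v≢x
      rewrite updateAt-updates x {const c} p | updateAt-minimal v x {const c} p v≢x = out v a
    ... | no u≢x   | yes refl
      rewrite updateAt-updates x {const c} p | updateAt-minimal u x {const c} p u≢x = into u a
    ... | no u≢x   | no v≢x
      rewrite updateAt-minimal u x {const c} p u≢x | updateAt-minimal v x {const c} p v≢x = lip u v a

∸-lipschitz : ∀ m {a b} → a ≤ suc b → m ∸ b ≤ suc (m ∸ a)
∸-lipschitz m {a} {b} a≤1+b = m≤n+o⇒m∸n≤o m b (begin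
  m                ≤⟨ m≤n+m∸n m a ⟩
  a + (m ∸ a)      ≤⟨ +-monoˡ-≤ (m ∸ a) a≤1+b ⟩
  suc b + (m ∸ a)  ≡⟨ +-suc b (m ∸ a) ⟨
  b + suc (m ∸ a)  ∎)
  where open ≤-Reasoning

diameter-≥1 : ∀ {n} (G : PlaneTriangulation n) (O : Orientation G) {u w} → u ≢ w → DiameterAtLeast G O 1
diameter-≥1 G O {u} {w} u≢w = u , w , λ { zero _ nil → u≢w refl ; (suc _) (s≤s ()) _ }

-- The nested triangles
-- Vertex (l , c) is corner c of the l-th triangle, and band i fills the annulus between the
-- triangles i and i + 1.  The dart (f , c) sits at corner c of the face f and runs to
-- corner c + 1, so φ turns it around its face and σ = φ ∘ α around its vertex.
Vertex : ℕ → Set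
Vertex n = Fin (suc n) × Fin 3

data Face (n : ℕ) : Set where
  inner outer : Face n
  band        : Fin n → Fin 6 → Face n

Dart : ℕ → Set
Dart n = Face n × Fin 3

data Side : Set where
  lower upper : Side

next : Fin 3 → Fin 3
next 0F = 1F
next 1F = 2F
next 2F = 0F

onBand : ∀ {n} → Fin n → Side × Fin 3 → Vertex n
onBand i (lower , c) = inject₁ i , c
onBand i (upper , c) = suc i , c

-- (lower , c) is the vertex (i , c) and (upper , c) is (i + 1 , c).  The only triangle
-- edges from (lower , 0) to the upper layer end at (upper , 0).
bandCorner : Fin 6 → Fin 3 → Side × Fin 3
bandCorner 0F 0F = lower , 1F
bandCorner 0F 1F = lower , 0F
bandCorner 0F 2F = upper , 0F
bandCorner 1F 0F = upper , 0F
bandCorner 1F 1F = upper , 1F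
bandCorner 1F 2F = lower , 1F
bandCorner 2F 0F = upper , 1F
bandCorner 2F 1F = upper , 2F
bandCorner 2F 2F = lower , 1F
bandCorner 3F 0F = lower , 2F
bandCorner 3F 1F = lower , 1F
bandCorner 3F 2F = upper , 2F
bandCorner 4F 0F = upper , 2F
bandCorner 4F 1F = upper , 0F
bandCorner 4F 2F = lower , 2F
bandCorner 5F 0F = lower , 0F
bandCorner 5F 1F = lower , 2F
bandCorner 5F 2F = upper , 0F

-- The outer face runs around the last triangle in the opposite direction.
corner : ∀ {n} → Face n → Fin 3 → Vertex n
corner     inner      c = zero , c
corner {n} outer      c = fromℕ n , next (opposite c)
corner     (band i t) c = onBand i (bandCorner t c)

-- The face above layer l is the outer face or, if l = inject₁ i, a triangle of band i.
data LayerView : ∀ {n} → Fin (suc n) → Set where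
  last : ∀ {n} → LayerView (fromℕ n)
  inj  : ∀ {n} (i : Fin n) → LayerView (inject₁ i)

layerView : ∀ {n} (l : Fin (suc n)) → LayerView l
layerView {zero}  zero    = last
layerView {suc n} zero    = inj zero
layerView {suc n} (suc l) with layerView l
... | last  = last
... | inj i = inj (suc i)

layerView-fromℕ : ∀ n → layerView (fromℕ n) ≡ last
layerView-fromℕ zero    = refl
layerView-fromℕ (suc n) rewrite layerView-fromℕ n = refl

layerView-inject₁ : ∀ {n} (i : Fin n) → layerView (inject₁ i) ≡ inj i
layerView-inject₁ zero    = refl
layerView-inject₁ (suc i) rewrite layerView-inject₁ i = refl

-- The triangles of band i on the edge {c, c + 1} of layer i, resp. of layer i + 1.
lowerEdgeTriangle upperEdgeTriangle : Fin 3 → Fin 6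
lowerEdgeTriangle 0F = 0F
lowerEdgeTriangle 1F = 3F
lowerEdgeTriangle 2F = 5F
upperEdgeTriangle 0F = 1F
upperEdgeTriangle 1F = 2F
upperEdgeTriangle 2F = 4F

-- The two darts on the edge {c, c + 1} of layer l, in the face above and below l.
dartAboveAt : ∀ {n} {l : Fin (suc n)} → LayerView l → Fin 3 → Dart n
dartAboveAt last    c = outer , opposite c
dartAboveAt (inj i) c = band i (lowerEdgeTriangle c) , 0F

dartAbove : ∀ {n} → Fin (suc n) → Fin 3 → Dart n
dartAbove l = dartAboveAt (layerView l)

dartBelow : ∀ {n} → Fin (suc n) → Fin 3 → Dart n
dartBelow zero    c = inner , c
dartBelow (suc i) c = band i (upperEdgeTriangle c) , 0F

dartAbove-inject₁ : ∀ {n} (i : Fin n) c → dartAbove (inject₁ i) c ≡ (band i (lowerEdgeTriangle c) , 0F)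
dartAbove-inject₁ i c = cong (λ v → dartAboveAt v c) (layerView-inject₁ i)

dartAbove-fromℕ : ∀ {n} c → dartAbove (fromℕ n) c ≡ (outer , opposite c)
dartAbove-fromℕ {n} c = cong (λ v → dartAboveAt v c) (layerView-fromℕ n)

α : ∀ {n} → Dart n → Dart n
α     (inner , c)       = dartAbove zero c
α {n} (outer , c)       = dartBelow (fromℕ n) (opposite c)
α (band i 0F , 0F) = dartBelow (inject₁ i) 0F
α (band i 0F , 1F) = band i 5F , 2F
α (band i 0F , 2F) = band i 1F , 2F
α (band i 1F , 0F) = dartAbove (suc i) 0F
α (band i 1F , 1F) = band i 2F , 2F
α (band i 1F , 2F) = band i 0F , 2F
α (band i 2F , 0F) = dartAbove (suc i) 1F
α (band i 2F , 1F) = band i 3F , 1F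
α (band i 2F , 2F) = band i 1F , 1F
α (band i 3F , 0F) = dartBelow (inject₁ i) 1F
α (band i 3F , 1F) = band i 2F , 1F
α (band i 3F , 2F) = band i 4F , 2F
α (band i 4F , 0F) = dartAbove (suc i) 2F
α (band i 4F , 1F) = band i 5F , 1F
α (band i 4F , 2F) = band i 3F , 2F
α (band i 5F , 0F) = dartBelow (inject₁ i) 2F
α (band i 5F , 1F) = band i 4F , 1F
α (band i 5F , 2F) = band i 0F , 1F

φ : ∀ {n} → Dart n → Dart n
φ (f , c) = f , next c

σ σ⁻ : ∀ {n} → Dart n → Dart n
σ x  = φ (α x)
σ⁻ x = α (φ (φ x))

vtx : ∀ {n} → Dart n → Vertex n
vtx (f , c) = corner f c

α-dartAbove : ∀ {n} (l : Fin (suc n)) c → α (dartAbove l c) ≡ dartBelow l c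
α-dartAbove l c = go (layerView l) c
  where
  go : ∀ {l : Fin (suc _)} (v : LayerView l) c → α (dartAboveAt v c) ≡ dartBelow l c
  go last    0F = refl
  go last    1F = refl
  go last    2F = refl
  go (inj i) 0F = refl
  go (inj i) 1F = refl
  go (inj i) 2F = refl

α-dartBelow : ∀ {n} (l : Fin (suc n)) c → α (dartBelow l c) ≡ dartAbove l c
α-dartBelow zero    c  = refl
α-dartBelow (suc i) 0F = refl
α-dartBelow (suc i) 1F = refl
α-dartBelow (suc i) 2F = refl

α-invol : ∀ {n} (x : Dart n) → α (α x) ≡ x
α-invol     (inner , c)       = α-dartAbove zero c
α-invol {n} (outer , 0F)      = trans (α-dartBelow (fromℕ n) 2F) (dartAbove-fromℕ 2F)
α-invol {n} (outer , 1F)      = trans (α-dartBelow (fromℕ n) 1F) (dartAbove-fromℕ 1F)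
α-invol {n} (outer , 2F)      = trans (α-dartBelow (fromℕ n) 0F) (dartAbove-fromℕ 0F)
α-invol (band i 0F , 0F) = trans (α-dartBelow (inject₁ i) 0F) (dartAbove-inject₁ i 0F)
α-invol (band i 0F , 1F) = refl
α-invol (band i 0F , 2F) = refl
α-invol (band i 1F , 0F) = α-dartAbove (suc i) 0F
α-invol (band i 1F , 1F) = refl
α-invol (band i 1F , 2F) = refl
α-invol (band i 2F , 0F) = α-dartAbove (suc i) 1F
α-invol (band i 2F , 1F) = refl
α-invol (band i 2F , 2F) = refl
α-invol (band i 3F , 0F) = trans (α-dartBelow (inject₁ i) 1F) (dartAbove-inject₁ i 1F)
α-invol (band i 3F , 1F) = refl
α-invol (band i 3F , 2F) = refl
α-invol (band i 4F , 0F) = α-dartAbove (suc i) 2F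
α-invol (band i 4F , 1F) = refl
α-invol (band i 4F , 2F) = refl
α-invol (band i 5F , 0F) = trans (α-dartBelow (inject₁ i) 2F) (dartAbove-inject₁ i 2F)
α-invol (band i 5F , 1F) = refl
α-invol (band i 5F , 2F) = refl

vtx-dartAbove : ∀ {n} (l : Fin (suc n)) c → vtx (dartAbove l c) ≡ (l , next c)
vtx-dartAbove l c = go (layerView l) c
  where
  go : ∀ {l : Fin (suc _)} (v : LayerView l) c → vtx (dartAboveAt v c) ≡ (l , next c)
  go last    0F = refl
  go last    1F = refl
  go last    2F = refl
  go (inj i) 0F = refl
  go (inj i) 1F = refl
  go (inj i) 2F = refl

vtx-dartBelow : ∀ {n} (l : Fin (suc n)) c → vtx (dartBelow l c) ≡ (l , c)
vtx-dartBelow zero    c  = refl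
vtx-dartBelow (suc i) 0F = refl
vtx-dartBelow (suc i) 1F = refl
vtx-dartBelow (suc i) 2F = refl

vtx-α : ∀ {n} (x : Dart n) → vtx (α x) ≡ vtx (φ x)
vtx-α     (inner , c)  = vtx-dartAbove zero c
vtx-α {n} (outer , 0F) = vtx-dartBelow (fromℕ n) 2F
vtx-α {n} (outer , 1F) = vtx-dartBelow (fromℕ n) 1F
vtx-α {n} (outer , 2F) = vtx-dartBelow (fromℕ n) 0F
vtx-α (band i 0F , 0F) = vtx-dartBelow (inject₁ i) 0F
vtx-α (band i 0F , 1F) = refl
vtx-α (band i 0F , 2F) = refl
vtx-α (band i 1F , 0F) = vtx-dartAbove (suc i) 0F
vtx-α (band i 1F , 1F) = refl
vtx-α (band i 1F , 2F) = refl
vtx-α (band i 2F , 0F) = vtx-dartAbove (suc i) 1F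
vtx-α (band i 2F , 1F) = refl
vtx-α (band i 2F , 2F) = refl
vtx-α (band i 3F , 0F) = vtx-dartBelow (inject₁ i) 1F
vtx-α (band i 3F , 1F) = refl
vtx-α (band i 3F , 2F) = refl
vtx-α (band i 4F , 0F) = vtx-dartAbove (suc i) 2F
vtx-α (band i 4F , 1F) = refl
vtx-α (band i 4F , 2F) = refl
vtx-α (band i 5F , 0F) = vtx-dartBelow (inject₁ i) 2F
vtx-α (band i 5F , 1F) = refl
vtx-α (band i 5F , 2F) = refl

next³ : ∀ c → next (next (next c)) ≡ c
next³ 0F = refl
next³ 1F = refl
next³ 2F = refl

φ³ : ∀ {n} (x : Dart n) → φ (φ (φ x)) ≡ x
φ³ (f , c) = cong (f ,_) (next³ c)

σ∘α : ∀ {n} (x : Dart n) → σ (α x) ≡ φ x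
σ∘α x = cong φ (α-invol x)

σ-inv₁ : ∀ {n} (x : Dart n) → σ (σ⁻ x) ≡ x
σ-inv₁ x = trans (σ∘α (φ (φ x))) (φ³ x)

σ-inv₂ : ∀ {n} (x : Dart n) → σ⁻ (σ x) ≡ x
σ-inv₂ x = trans (cong α (φ³ (α x))) (α-invol x)

vtx-σ : ∀ {n} (x : Dart n) → vtx (σ x) ≡ vtx x
vtx-σ x = trans (sym (vtx-α (α x))) (cong vtx (α-invol x))

anchor : ∀ {n} → Vertex n → Dart n
anchor (l , c) = φ (dartAbove l c)

anchor-inject₁ : ∀ {n} (i : Fin n) c → anchor (inject₁ i , c) ≡ (band i (lowerEdgeTriangle c) , 1F)
anchor-inject₁ i c = cong φ (dartAbove-inject₁ i c)

anchor-fromℕ : ∀ {n} c → anchor (fromℕ n , c) ≡ (outer , next (opposite c))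
anchor-fromℕ c = cong φ (dartAbove-fromℕ c)

-- Each count is the number of σ-steps to the anchor, checked by evaluating σ.  Around a
-- lower vertex of band i the count depends on whether the face below it is inner (i = 0).
forward : ∀ {n} (x : Dart n) → Orbit σ x (anchor (vtx x))
forward (inner , c) = 1 , refl
forward {zero} (outer , 0F) = 2 , refl
forward {zero} (outer , 1F) = 2 , refl
forward {zero} (outer , 2F) = 2 , refl
forward {suc n} (outer , 0F) = 5 , refl
forward {suc n} (outer , 1F) = 4 , refl
forward {suc n} (outer , 2F) = 3 , refl
forward (band zero    0F , 0F) = 2 , refl
forward (band (suc j) 0F , 0F) = 3 , refl
forward (band zero    0F , 1F) = 3 , refl
forward (band (suc j) 0F , 1F) = 6 , refl
forward (band i 0F , 2F) = 2 , refl
forward (band i 1F , 0F) = 1 , refl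
forward (band i 1F , 1F) = 2 , refl
forward (band zero    1F , 2F) = 3 , refl
forward (band (suc j) 1F , 2F) = 4 , refl
forward (band i 2F , 0F) = 1 , refl
forward (band i 2F , 1F) = 3 , refl
forward (band zero    2F , 2F) = 4 , refl
forward (band (suc j) 2F , 2F) = 5 , refl
forward (band zero    3F , 0F) = 2 , refl
forward (band (suc j) 3F , 0F) = 4 , refl
forward (band zero    3F , 1F) = 5 , refl
forward (band (suc j) 3F , 1F) = 6 , refl
forward (band i 3F , 2F) = 2 , refl
forward (band i 4F , 0F) = 1 , refl
forward (band i 4F , 1F) = 4 , refl
forward (band zero    4F , 2F) = 3 , refl
forward (band (suc j) 4F , 2F) = 5 , refl
forward (band zero    5F , 0F) = 2 , refl
forward (band (suc j) 5F , 0F) = 5 , refl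
forward (band zero    5F , 1F) = 4 , refl
forward (band (suc j) 5F , 1F) = 6 , refl
forward (band i 5F , 2F) = 3 , refl

fromLower : ∀ {n} (i : Fin n) c k → Orbit σ (anchor (inject₁ i , c)) (iter k σ (band i (lowerEdgeTriangle c) , 1F))
fromLower i c = orbit-from (anchor-inject₁ i c)

fromOuter : ∀ {n} c k → Orbit σ (anchor (fromℕ n , c)) (iter k σ (outer , next (opposite c)))
fromOuter c = orbit-from (anchor-fromℕ c)

entryDart : ∀ {n} → Fin n → Fin 3 → Dart n
entryDart j 0F = band j 4F , 1F
entryDart j 1F = band j 1F , 1F
entryDart j 2F = band j 2F , 1F

upper-entry : ∀ {n} (j : Fin n) c → Orbit σ (anchor (suc j , c)) (entryDart j c)
upper-entry {suc n} j = go (layerView j)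
  where
  go : ∀ {j : Fin (suc n)} → LayerView j → ∀ c → Orbit σ (anchor (suc j , c)) (entryDart j c)
  go last 0F = fromOuter 0F 1
  go last 1F = fromOuter 1F 1
  go last 2F = fromOuter 2F 1
  go (inj i) 0F = orbit-post (fromLower (suc i) 0F 1)
  go (inj i) 1F = orbit-post (fromLower (suc i) 1F 3)
  go (inj i) 2F = orbit-post (fromLower (suc i) 2F 2)

fromUpper : ∀ {n} (j : Fin n) c k → Orbit σ (anchor (suc j , c)) (iter k σ (entryDart j c))
fromUpper j c k = orbit-trans (upper-entry j c) (k , refl)

-- From an anchor σ first leaves the face above the layer, which is only known after
-- anchor-inject₁, anchor-fromℕ or upper-entry.
backward : ∀ {n} (x : Dart n) → Orbit σ (anchor (vtx x)) x
backward {zero}  (inner , 0F) = 1 , refl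
backward {zero}  (inner , 1F) = 1 , refl
backward {zero}  (inner , 2F) = 1 , refl
backward {suc n} (inner , 0F) = orbit-post (fromLower zero 0F 1)
backward {suc n} (inner , 1F) = orbit-post (fromLower zero 1F 3)
backward {suc n} (inner , 2F) = orbit-post (fromLower zero 2F 2)
backward (outer , 0F) = fromOuter 0F 0
backward (outer , 1F) = fromOuter 2F 0
backward (outer , 2F) = fromOuter 1F 0
backward (band i 0F , 0F) = fromLower i 1F 3
backward (band i 0F , 1F) = fromLower i 0F 0
backward (band i 0F , 2F) = fromUpper i 0F 2
backward (band i 1F , 0F) = fromUpper i 0F 3
backward (band i 1F , 1F) = fromUpper i 1F 0
backward (band i 1F , 2F) = fromLower i 1F 2
backward (band i 2F , 0F) = fromUpper i 1F 1
backward (band i 2F , 1F) = fromUpper i 2F 0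
backward (band i 2F , 2F) = fromLower i 1F 1
backward (band i 3F , 0F) = fromLower i 2F 2
backward (band i 3F , 1F) = fromLower i 1F 0
backward (band i 3F , 2F) = fromUpper i 2F 1
backward (band i 4F , 0F) = fromUpper i 2F 2
backward (band i 4F , 1F) = fromUpper i 0F 0
backward (band i 4F , 2F) = fromLower i 2F 1
backward (band i 5F , 0F) = fromLower i 0F 1
backward (band i 5F , 1F) = fromLower i 2F 0
backward (band i 5F , 2F) = fromUpper i 0F 1

vtx-orbit : ∀ {n} (x y : Dart n) → vtx x ≡ vtx y → Orbit σ x y
vtx-orbit x y p = orbit-trans (forward x) (subst (λ v → Orbit σ (anchor v) y) (sym p) (backward y))

Reach : ∀ {n} → Dart n → Dart n → Set
Reach = MapReachOn σ σ⁻ α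

reach-φ : ∀ {n} {x y : Dart n} → Reach x y → Reach x (φ y)
reach-φ {y = y} p = subst (Reach _) (σ∘α y) (stepσ (stepα p))

reach-face : ∀ {n} {x : Dart n} {f c} → Reach x (f , c) → ∀ c′ → Reach x (f , c′)
reach-face {c = c} p c′ = fromZero (toZero c p) c′
  where
  toZero : ∀ {x f} c → Reach x (f , c) → Reach x (f , 0F)
  toZero 0F p = p
  toZero 1F p = reach-φ (reach-φ p)
  toZero 2F p = reach-φ p
  fromZero : ∀ {x f} → Reach x (f , 0F) → ∀ c′ → Reach x (f , c′)
  fromZero p 0F = p
  fromZero p 1F = reach-φ p
  fromZero p 2F = reach-φ (reach-φ p)

reach-band : ∀ {n} {x : Dart n} {i} → Reach x (band i 0F , 0F) → ∀ t c → Reach x (band i t , c)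
reach-band {x = x} {i} p t = reach-face (triangle t)
  where
  across : ∀ {t} → Reach x (band i t , 0F) → ∀ c → Reach x (α (band i t , c))
  across q c = stepα (reach-face q c)
  r₁ r₂ r₃ r₄ r₅ : Reach x (band i _ , 0F)
  r₁ = reach-face (across p  2F) 0F
  r₂ = reach-face (across r₁ 1F) 0F
  r₃ = reach-face (across r₂ 1F) 0F
  r₄ = reach-face (across r₃ 2F) 0F
  r₅ = reach-face (across r₄ 1F) 0F
  triangle : ∀ t → Reach x (band i t , 0F)
  triangle 0F = p
  triangle 1F = r₁
  triangle 2F = r₂
  triangle 3F = r₃
  triangle 4F = r₄
  triangle 5F = r₅

reach-bands : ∀ {n} (i : Fin (suc n)) → Reach {suc n} (inner , 0F) (band i 0F , 0F)
reach-bands {n} = <-weakInduction (λ i → Reach (inner , 0F) (band i 0F , 0F)) first step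
  where
  first : Reach (inner , 0F) (band zero 0F , 0F)
  first = stepα here
  step : ∀ i → Reach (inner , 0F) (band (inject₁ i) 0F , 0F) → Reach (inner , 0F) (band (suc i) 0F , 0F)
  step i p = subst (Reach _) (dartAbove-inject₁ (suc i) 0F) (stepα (reach-band p 1F 0F))

reach-all : ∀ {n} (y : Dart n) → Reach (inner , 0F) y
reach-all         (inner , c)      = reach-face here c
reach-all {zero}  (outer , c)      = reach-face (stepα here) c
reach-all {suc n} (outer , c)      =
  reach-face (subst (Reach _) (dartAbove-fromℕ 0F) (stepα (reach-band (reach-bands (fromℕ n)) 1F 0F))) c
reach-all {suc n} (band i t , c)   = reach-band (reach-bands i) t c

connected : ∀ {n} (x y : Dart n) → Reach x y
connected x y = reach-trans σ-inv₁ σ-inv₂ α-invol (reach-sym σ-inv₁ σ-inv₂ α-invol (reach-all x)) (reach-all y)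

c≢next : ∀ c → c ≢ next c
c≢next 0F ()
c≢next 1F ()
c≢next 2F ()

inject₁≢suc : ∀ {n} (i : Fin n) → inject₁ i ≢ suc i
inject₁≢suc zero    ()
inject₁≢suc (suc i) p = inject₁≢suc i (suc-injective p)

onBand-injective : ∀ {n} (i : Fin n) {a b} → onBand i a ≡ onBand i b → a ≡ b
onBand-injective i {lower , _} {lower , _} refl = refl
onBand-injective i {upper , _} {upper , _} refl = refl
onBand-injective i {lower , _} {upper , _} p    = ⊥-elim (inject₁≢suc i (cong proj₁ p))
onBand-injective i {upper , _} {lower , _} p    = ⊥-elim (inject₁≢suc i (sym (cong proj₁ p)))

bandCorner-next-≢ : ∀ t c → bandCorner t c ≢ bandCorner t (next c)
bandCorner-next-≢ 0F 0F ()
bandCorner-next-≢ 0F 1F ()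
bandCorner-next-≢ 0F 2F ()
bandCorner-next-≢ 1F 0F ()
bandCorner-next-≢ 1F 1F ()
bandCorner-next-≢ 1F 2F ()
bandCorner-next-≢ 2F 0F ()
bandCorner-next-≢ 2F 1F ()
bandCorner-next-≢ 2F 2F ()
bandCorner-next-≢ 3F 0F ()
bandCorner-next-≢ 3F 1F ()
bandCorner-next-≢ 3F 2F ()
bandCorner-next-≢ 4F 0F ()
bandCorner-next-≢ 4F 1F ()
bandCorner-next-≢ 4F 2F ()
bandCorner-next-≢ 5F 0F ()
bandCorner-next-≢ 5F 1F ()
bandCorner-next-≢ 5F 2F ()

vtx-φ-≢ : ∀ {n} (x : Dart n) → vtx x ≢ vtx (φ x)
vtx-φ-≢ (inner , c)      p = c≢next c (cong proj₂ p)
vtx-φ-≢ (outer , 0F)     ()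
vtx-φ-≢ (outer , 1F)     ()
vtx-φ-≢ (outer , 2F)     ()
vtx-φ-≢ (band i t , c)   p = bandCorner-next-≢ t c (onBand-injective i p)

-- How the layers of two vertices compare; far is a catch-all for the remaining pairs.
data LayerStep {n : ℕ} : Fin (suc n) → Fin (suc n) → Set where
  same : ∀ l → LayerStep l l
  up   : ∀ (i : Fin n) → LayerStep (inject₁ i) (suc i)
  down : ∀ (i : Fin n) → LayerStep (suc i) (inject₁ i)
  far  : ∀ l l′ → LayerStep l l′

liftStep : ∀ {n} {l l′ : Fin (suc n)} → LayerStep l l′ → LayerStep {suc n} (suc l) (suc l′)
liftStep (same l)   = same (suc l)
liftStep (up i)     = up (suc i)
liftStep (down i)   = down (suc i)
liftStep (far l l′) = far (suc l) (suc l′)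

layerStep : ∀ {n} (l l′ : Fin (suc n)) → LayerStep l l′
layerStep zero    zero     = same zero
layerStep zero    (suc l′) = fromBottom l′
  where
  fromBottom : ∀ {n} (l′ : Fin n) → LayerStep zero (suc l′)
  fromBottom zero     = up zero
  fromBottom (suc l′) = far zero (suc (suc l′))
layerStep (suc l) zero     = toBottom l
  where
  toBottom : ∀ {n} (l : Fin n) → LayerStep (suc l) zero
  toBottom zero    = down zero
  toBottom (suc l) = far (suc (suc l)) zero
layerStep {suc n} (suc l) (suc l′) = liftStep (layerStep l l′)

layerStep-same : ∀ {n} (l : Fin (suc n)) → layerStep l l ≡ same l
layerStep-same         zero    = refl
layerStep-same {suc n} (suc l) rewrite layerStep-same l = refl

layerStep-up : ∀ {n} (i : Fin n) → layerStep (inject₁ i) (suc i) ≡ up i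
layerStep-up         zero    = refl
layerStep-up {suc n} (suc i) rewrite layerStep-up i = refl

layerStep-down : ∀ {n} (i : Fin n) → layerStep (suc i) (inject₁ i) ≡ down i
layerStep-down         zero    = refl
layerStep-down {suc n} (suc i) rewrite layerStep-down i = refl

-- Pairs of vertices that are not joined by an edge are sent to an arbitrary dart.
junk : ∀ {n} → Dart n
junk = inner , 0F

flatDart : ∀ {n} → Fin (suc n) → Fin 3 → Fin 3 → Dart n
flatDart l 0F 1F = dartBelow l 0F
flatDart l 1F 2F = dartBelow l 1F
flatDart l 2F 0F = dartBelow l 2F
flatDart l 1F 0F = dartAbove l 0F
flatDart l 2F 1F = dartAbove l 1F
flatDart l 0F 2F = dartAbove l 2F
flatDart l _  _  = junk

risingDart : ∀ {n} → Fin n → Fin 3 → Fin 3 → Dart n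
risingDart i 0F 0F = band i 0F , 1F
risingDart i 1F 0F = band i 1F , 2F
risingDart i 1F 1F = band i 2F , 2F
risingDart i 1F 2F = band i 3F , 1F
risingDart i 2F 2F = band i 4F , 2F
risingDart i 2F 0F = band i 5F , 1F
risingDart i _  _  = junk

fallingDart : ∀ {n} → Fin n → Fin 3 → Fin 3 → Dart n
fallingDart i 0F 0F = band i 5F , 2F
fallingDart i 0F 1F = band i 0F , 2F
fallingDart i 1F 1F = band i 1F , 1F
fallingDart i 2F 1F = band i 2F , 1F
fallingDart i 2F 2F = band i 3F , 2F
fallingDart i 0F 2F = band i 4F , 1F
fallingDart i _  _  = junk

stepDart : ∀ {n} {l l′ : Fin (suc n)} → LayerStep l l′ → Fin 3 → Fin 3 → Dart n
stepDart (same l)    = flatDart l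
stepDart (up i)      = risingDart i
stepDart (down i)    = fallingDart i
stepDart (far _ _) _ _ = junk

edgeDart : ∀ {n} → Vertex n → Vertex n → Dart n
edgeDart (l , c) (l′ , c′) = stepDart (layerStep l l′) c c′

edgeDart-vtx : ∀ {n} (x : Dart n) → edgeDart (vtx x) (vtx (φ x)) ≡ x
edgeDart-vtx (inner , 0F) = refl
edgeDart-vtx (inner , 1F) = refl
edgeDart-vtx (inner , 2F) = refl
edgeDart-vtx {n} (outer , 0F) rewrite layerStep-same (fromℕ n) = dartAbove-fromℕ 2F
edgeDart-vtx {n} (outer , 1F) rewrite layerStep-same (fromℕ n) = dartAbove-fromℕ 1F
edgeDart-vtx {n} (outer , 2F) rewrite layerStep-same (fromℕ n) = dartAbove-fromℕ 0F
edgeDart-vtx (band i 0F , 0F) rewrite layerStep-same (inject₁ i) = dartAbove-inject₁ i 0F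
edgeDart-vtx (band i 0F , 1F) rewrite layerStep-up i             = refl
edgeDart-vtx (band i 0F , 2F) rewrite layerStep-down i           = refl
edgeDart-vtx (band i 1F , 0F) rewrite layerStep-same (suc i)     = refl
edgeDart-vtx (band i 1F , 1F) rewrite layerStep-down i           = refl
edgeDart-vtx (band i 1F , 2F) rewrite layerStep-up i             = refl
edgeDart-vtx (band i 2F , 0F) rewrite layerStep-same (suc i)     = refl
edgeDart-vtx (band i 2F , 1F) rewrite layerStep-down i           = refl
edgeDart-vtx (band i 2F , 2F) rewrite layerStep-up i             = refl
edgeDart-vtx (band i 3F , 0F) rewrite layerStep-same (inject₁ i) = dartAbove-inject₁ i 1F
edgeDart-vtx (band i 3F , 1F) rewrite layerStep-up i             = refl
edgeDart-vtx (band i 3F , 2F) rewrite layerStep-down i           = refl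
edgeDart-vtx (band i 4F , 0F) rewrite layerStep-same (suc i)     = refl
edgeDart-vtx (band i 4F , 1F) rewrite layerStep-down i           = refl
edgeDart-vtx (band i 4F , 2F) rewrite layerStep-up i             = refl
edgeDart-vtx (band i 5F , 0F) rewrite layerStep-same (inject₁ i) = dartAbove-inject₁ i 2F
edgeDart-vtx (band i 5F , 1F) rewrite layerStep-up i             = refl
edgeDart-vtx (band i 5F , 2F) rewrite layerStep-down i           = refl

noMulti : ∀ {n} (x y : Dart n) → vtx x ≡ vtx y → vtx (α x) ≡ vtx (α y) → x ≡ y
noMulti x y p q = begin
  x                              ≡⟨ edgeDart-vtx x ⟨
  edgeDart (vtx x) (vtx (φ x))   ≡⟨ cong₂ edgeDart p (trans (sym (vtx-α x)) (trans q (vtx-α y))) ⟩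
  edgeDart (vtx y) (vtx (φ y))   ≡⟨ edgeDart-vtx y ⟩
  y                              ∎
  where open ≡-Reasoning

layer : ∀ {n} → Vertex n → ℕ
layer (l , _) = toℕ l

onBand-layer : ∀ {n} (i : Fin n) a b → layer (onBand i b) ≤ suc (layer (onBand i a))
onBand-layer i (lower , _) (lower , _) = n≤1+n _
onBand-layer i (upper , _) (upper , _) = n≤1+n _
onBand-layer i (lower , _) (upper , _) = s≤s (≤-reflexive (sym (toℕ-inject₁ i)))
onBand-layer i (upper , _) (lower , _) = ≤-trans (≤-reflexive (toℕ-inject₁ i)) (≤-trans (n≤1+n _) (n≤1+n _))

layer-φ : ∀ {n} (x : Dart n) → layer (vtx (φ x)) ≤ suc (layer (vtx x))
layer-φ (inner , c)    = n≤1+n _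
layer-φ (outer , c)    = n≤1+n _
layer-φ (band i t , c) = onBand-layer i (bandCorner t c) (bandCorner t (next c))

layer-α : ∀ {n} (x : Dart n) → layer (vtx (α x)) ≤ suc (layer (vtx x))
layer-α x = subst (λ v → layer v ≤ suc (layer (vtx x))) (sym (vtx-α x)) (layer-φ x)

onBand-suc≢zero : ∀ {n} (i : Fin n) a → proj₁ (onBand (suc i) a) ≢ zero
onBand-suc≢zero i (lower , _) ()
onBand-suc≢zero i (upper , _) ()

first-corner-neighbours : ∀ {n} (x : Dart (suc n)) → vtx x ≡ (zero , 0F) →
                          vtx (φ x) ≡ (1F , 0F) ⊎ layer (vtx (φ x)) ≡ 0
first-corner-neighbours (inner , 0F)          refl = inj₂ refl
first-corner-neighbours (band zero 0F , 1F)   refl = inj₁ refl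
first-corner-neighbours (band zero 5F , 0F)   refl = inj₂ refl
first-corner-neighbours (band (suc i) t , c)  p    = ⊥-elim (onBand-suc≢zero i (bandCorner t c) (cong proj₁ p))
first-corner-neighbours (inner , 1F)          ()
first-corner-neighbours (inner , 2F)          ()
first-corner-neighbours (outer , c)           ()
first-corner-neighbours (band zero 0F , 0F)   ()
first-corner-neighbours (band zero 0F , 2F)   ()
first-corner-neighbours (band zero 1F , 0F)   ()
first-corner-neighbours (band zero 1F , 1F)   ()
first-corner-neighbours (band zero 1F , 2F)   ()
first-corner-neighbours (band zero 2F , 0F)   ()
first-corner-neighbours (band zero 2F , 1F)   ()
first-corner-neighbours (band zero 2F , 2F)   ()
first-corner-neighbours (band zero 3F , 0F)   ()
first-corner-neighbours (band zero 3F , 1F)   ()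
first-corner-neighbours (band zero 3F , 2F)   ()
first-corner-neighbours (band zero 4F , 0F)   ()
first-corner-neighbours (band zero 4F , 1F)   ()
first-corner-neighbours (band zero 4F , 2F)   ()
first-corner-neighbours (band zero 5F , 1F)   ()
first-corner-neighbours (band zero 5F , 2F)   ()

nested : ∀ n → Triangulation (Dart n) (Vertex n)
nested n = record
  { σ = σ ; σ⁻ = σ⁻ ; α = α
  ; σ-inv₁ = σ-inv₁
  ; σ-inv₂ = σ-inv₂
  ; α-invol = α-invol
  ; α-nofix = λ x p → vtx-φ-≢ x (sym (trans (sym (vtx-α x)) (cong vtx p)))
  ; vtx = vtx
  ; vtx-σ = vtx-σ
  ; vtx-orbit = vtx-orbit
  ; vtx-surj = λ (l , c) → dartBelow l c , vtx-dartBelow l c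
  ; connected = connected
  ; noLoop = λ x p → vtx-φ-≢ x (sym (trans (sym (vtx-α x)) p))
  ; noMulti = noMulti
  ; face3 = λ x → trans (iter-cong σ∘α 3 x) (φ³ x)
  ; faceNo1 = λ x p → vtx-φ-≢ x (cong vtx (sym (trans (sym (σ∘α x)) p)))
  ; faceVtx₁ = λ x p → vtx-φ-≢ x (trans p (cong vtx (σ∘α x)))
  ; faceVtx₂ = λ x p → vtx-φ-≢ (φ (φ x))
      (sym (trans (cong vtx (φ³ x)) (trans p (cong vtx (iter-cong σ∘α 2 x)))))
  }

-- Opaque: only their inverse laws are used, and unfolding them makes type checking very slow.
opaque
  face↔ : ∀ {n} → Face n ↔ (⊤ ⊎ ⊤ ⊎ Fin n × Fin 6)
  face↔ {n} = mk↔ₛ′ to from to∘from from∘to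
    where
    to : Face n → ⊤ ⊎ ⊤ ⊎ Fin n × Fin 6
    to inner      = inj₁ tt
    to outer      = inj₂ (inj₁ tt)
    to (band i t) = inj₂ (inj₂ (i , t))
    from : ⊤ ⊎ ⊤ ⊎ Fin n × Fin 6 → Face n
    from (inj₁ _)                = inner
    from (inj₂ (inj₁ _))         = outer
    from (inj₂ (inj₂ (i , t)))   = band i t
    to∘from : ∀ y → to (from y) ≡ y
    to∘from (inj₁ _)              = refl
    to∘from (inj₂ (inj₁ _))       = refl
    to∘from (inj₂ (inj₂ _))       = refl
    from∘to : ∀ x → from (to x) ≡ x
    from∘to inner      = refl
    from∘to outer      = refl
    from∘to (band i t) = refl

  dart↔ : ∀ {n} → Dart n ↔ Fin ((2 + n * 6) * 3)
  dart↔ {n} = ↔-trans (×-cong faces ↔-refl) (↔-sym *↔×)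
    where
    faces : Face n ↔ Fin (2 + n * 6)
    faces = ↔-trans face↔ (↔-sym (↔-trans (+↔⊎ {1}) (⊎-cong 1↔⊤ (↔-trans (+↔⊎ {1}) (⊎-cong 1↔⊤ *↔×)))))

  vertex↔ : ∀ {n} → Vertex n ↔ Fin (3 * suc n)
  vertex↔ = ↔-trans (×-comm _ _) (↔-sym *↔×)

nested-euler : ∀ n → 6 * (3 * suc n) ≡ (2 + n * 6) * 3 + 12
nested-euler = solve 1 (λ n → con 6 :* (con 3 :* (con 1 :+ n)) := (con 2 :+ n :* con 6) :* con 3 :+ con 12) refl
  where open +-*-Solver

module NestedTriangles (n : ℕ) = Transport dart↔ vertex↔ (nested n) (m≤m*n 3 (suc n)) (nested-euler n)

nestedTriangles : ∀ n → PlaneTriangulation (3 * suc n)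
nestedTriangles n = NestedTriangles.transport n

layerOf : ∀ {n} → Fin (3 * suc n) → ℕ
layerOf = layer ∘ Inverse.from vertex↔

layerOf-to : ∀ {n} (v : Vertex n) → layerOf {n} (Inverse.to vertex↔ v) ≡ layer v
layerOf-to v = cong layer (Inverse.strictlyInverseʳ vertex↔ v)

Adj-layer : ∀ {n u w} → PlaneTriangulation.Adj (nestedTriangles n) u w → layerOf {n} w ≤ suc (layerOf u)
Adj-layer {n} adj with NestedTriangles.transport-Adj n adj
... | x , p , q = subst₂ (λ a b → layer a ≤ suc (layer b)) q p (layer-α x)

module _ {n : ℕ} where
  private
    G = nestedTriangles (suc n)
    open PlaneTriangulation G using (Adj)
    module V = Inverse (vertex↔ {suc n})
    ℓ : Fin (3 * suc (suc n)) → ℕ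
    ℓ = layerOf {suc n}

  x₀ w₀ y₀ : Fin (3 * suc (suc n))
  x₀ = V.to (zero , 0F)
  w₀ = V.to (1F , 0F)
  y₀ = V.to (fromℕ (suc n) , 0F)

  x₀-neighbours : ∀ {w} → Adj x₀ w → w ≡ w₀ ⊎ ℓ w ≡ 0
  x₀-neighbours {w} adj with NestedTriangles.transport-Adj (suc n) adj
  ... | x , p , q with first-corner-neighbours x (trans p (V.strictlyInverseʳ _))
  ...   | inj₁ r = inj₁ (trans (sym (V.strictlyInverseˡ w)) (cong V.to (trans (sym q) (trans (vtx-α x) r))))
  ...   | inj₂ r = inj₂ (trans (cong layer (sym q)) (trans (cong layer (vtx-α x)) r))

  y₀-layer : ℓ y₀ ≡ suc n
  y₀-layer = trans (layerOf-to {suc n} _) (toℕ-fromℕ (suc n))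

  y₀≢x₀ : y₀ ≢ x₀
  y₀≢x₀ p = 1+n≢0 (trans (sym y₀-layer) (trans (cong ℓ p) (layerOf-to {suc n} _)))

  module _ (O : Orientation G) where
    open Orientation O

    dist-from-x₀ : arc x₀ w₀ ≡ false → DistAtLeast G O x₀ y₀ (suc (suc n))
    dist-from-x₀ x₀↛w₀ = potential-dist G O (updateAt-lipschitz G O rising out λ _ _ → z≤n)
      (updateAt-updates x₀ _) (trans (updateAt-minimal y₀ x₀ _ y₀≢x₀) (cong suc y₀-layer))
      where
      rising : ArcLipschitz G O (λ u → suc (ℓ u))
      rising u v a = s≤s (Adj-layer (arc-edge u v a))
      out : ∀ v → arc x₀ v ≡ true → suc (ℓ v) ≤ 1
      out v a with x₀-neighbours (arc-edge x₀ v a)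
      ... | inj₁ refl = contradiction (trans (sym a) x₀↛w₀) λ ()
      ... | inj₂ p    = s≤s (≤-reflexive p)

    dist-to-x₀ : arc w₀ x₀ ≡ false → DistAtLeast G O y₀ x₀ (suc (suc n))
    dist-to-x₀ w₀↛x₀ = potential-dist G O (updateAt-lipschitz G O falling (λ _ _ → out) into)
      (trans (updateAt-minimal y₀ x₀ _ y₀≢x₀) (trans (cong (suc n ∸_) y₀-layer) (n∸n≡0 (suc n))))
      (updateAt-updates x₀ _)
      where
      falling : ArcLipschitz G O (λ u → suc n ∸ ℓ u)
      falling u v a = ∸-lipschitz (suc n) (Adj-layer (Adj-sym G (arc-edge u v a)))
      out : ∀ {v} → suc n ∸ ℓ v ≤ suc (suc (suc n))
      out {v} = ≤-trans (m∸n≤m (suc n) (ℓ v)) (≤-trans (n≤1+n _) (n≤1+n _))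
      into : ∀ u → arc u x₀ ≡ true → suc (suc n) ≤ suc (suc n ∸ ℓ u)
      into u a with x₀-neighbours (Adj-sym G (arc-edge u x₀ a))
      ... | inj₁ refl = contradiction (trans (sym a) w₀↛x₀) λ ()
      ... | inj₂ p    = subst (λ k → suc (suc n) ≤ suc (suc n ∸ k)) (sym p) ≤-refl

    nested-diameter : DiameterAtLeast G O (suc (suc n))
    nested-diameter = byArc (arc x₀ w₀) refl
      where
      byArc : ∀ b → arc x₀ w₀ ≡ b → DiameterAtLeast G O (suc (suc n))
      byArc false x₀↛w₀ = x₀ , y₀ , dist-from-x₀ x₀↛w₀
      byArc true  x₀→w₀ = y₀ , x₀ , dist-to-x₀ (antisym x₀ w₀ x₀→w₀)

theorem3 : ∀ (m : ℕ) → 1 ≤ m → ∃[ G ] OrientedDiameterAtLeast {3 * m} G m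
theorem3 (suc zero)    _ = nestedTriangles 0 , λ O _ → diameter-≥1 _ O {0F} {1F} λ ()
theorem3 (suc (suc n)) _ = nestedTriangles (suc n) , λ O _ → nested-diameter O
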